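{- Let $\mathbf{P}=(p_{ij})$ be an instance of makespan minimization on $m$ unrelated machines, let $T>0$, $L>0$ with $L\le T$, and let $h=h(T)\in(0,1]$ be the feasibility factor of $\mathbf{P}$ with $h\ge L/T$. Let $\alpha$ be an assignment of makespan at most $2T$ and average machine load $L$. Then the bipartite graph $G_{\alpha,1/h}$ has a matching that saturates every vertex of $\mathrm{Bad}(\alpha,1/h)$.
   Context: Machines $\mathcal{M}$ ($|\mathcal{M}|=m$), jobs $\mathcal{J}$, processing times $p_{ij}\ge0$. An assignment is $\alpha:\mathcal{J}\to\mathcal{M}$, load $\delta_i(\alpha)=\sum_{j:\alpha(j)=i}p_{ij}$, makespan $\max_i\delta_i(\alpha)$, average machine load $\frac1m\sum_i\delta_i(\alpha)$. Machine $i$ is legal for job $j$ if $p_{ij}\le T$; the feasibility factor is $h(T)=\frac1m\min_j|\{i:p_{ij}\le T\}|$. For $\gamma\ge1$: $\mathrm{Bad}(\alpha,\gamma)=\{i:\delta_i(\alpha)>T+\gamma L\}$, $\mathrm{Good}(\alpha,\gamma)=\{i:\delta_i(\alpha)\le\gamma L\}$. For a machine $i$ with at least one job, $j^i_{\max}$ is a job assigned to $i$ with maximum $p_{ij}$. $G_{\alpha,\gamma}$ is the bipartite graph with sides $\mathrm{Bad}(\alpha,\gamma)$ and $\mathrm{Good}(\alpha,\gamma)$, with an edge $(i,i')$ iff $i'$ is legal for $j^i_{\max}$.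
   Formalization: The processing times $p_{ij}$ and the values T and L are rational. -}

module Defs where

open import Data.Nat using (ℕ; NonZero)
open import Data.Fin using (Fin)
open import Data.List using (List; foldr; map; filter; length; allFin)
open import Data.Integer using (+_)
open import Data.Rational using (ℚ; 0ℚ; 1ℚ; _+_; _*_; _≤_; _<_; _/_; 1/_; _÷_; positive)
open import Data.Rational.Properties using (_≤?_; pos⇒nonZero)
open import Data.Fin using (_≟_)
open import Data.Product using (Σ; _×_; ∃-syntax)
open import Relation.Binary.PropositionalEquality using (_≡_)

-- An instance: m machines (Fin m), n jobs (Fin n), processing times p i j.
Instance : ℕ → ℕ → Set
Instance m n = Fin m → Fin n → ℚ

Assignment : ℕ → ℕ → Set
Assignment m n = Fin n → Fin m

sumFin : {n : ℕ} → (Fin n → ℚ) → ℚ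
sumFin {n} f = foldr _+_ 0ℚ (map f (allFin n))

load : {m n : ℕ} → Instance m n → Assignment m n → Fin m → ℚ
load {m} {n} p α i = foldr _+_ 0ℚ (map (p i) (filter (λ j → α j ≟ i) (allFin n)))

MakespanAtMost : {m n : ℕ} → Instance m n → Assignment m n → ℚ → Set
MakespanAtMost p α C = ∀ i → load p α i ≤ C

averageLoad : {m n : ℕ} → .{{NonZero m}} → Instance m n → Assignment m n → ℚ
averageLoad {m} p α = sumFin (load p α) * ((+ 1) / m)

Legal : {m n : ℕ} → Instance m n → ℚ → Fin m → Fin n → Set
Legal p T i j = p i j ≤ T

legalCount : {m n : ℕ} → Instance m n → ℚ → Fin n → ℕ
legalCount {m} p T j = length (filter (λ i → p i j ≤? T) (allFin m))

-- h is the feasibility factor h(T) = (1/m) min_j |{i : p_ij ≤ T}|,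
-- i.e. h is a lower bound of all values (1/m)|legal(j)| and is attained.
IsFeasibilityFactor : {m n : ℕ} → .{{NonZero m}} → Instance m n → ℚ → ℚ → Set
IsFeasibilityFactor {m} p T h =
  (∀ j → h ≤ (+ legalCount p T j) / m) × (∃[ j ] h ≡ (+ legalCount p T j) / m)

inv : (h : ℚ) → 0ℚ < h → ℚ
inv h hpos = 1/_ h {{pos⇒nonZero h {{positive hpos}}}}

Bad : {m n : ℕ} → Instance m n → Assignment m n → ℚ → ℚ → ℚ → Fin m → Set
Bad p α T L γ i = T + γ * L < load p α i

Good : {m n : ℕ} → Instance m n → Assignment m n → ℚ → ℚ → Fin m → Set
Good p α L γ i = load p α i ≤ γ * L

IsMaxJobChoice : {m n : ℕ} → Instance m n → Assignment m n → (Fin m → Fin n) → Set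
IsMaxJobChoice p α jmax =
  ∀ i j → α j ≡ i → (α (jmax i) ≡ i) × (p i j ≤ p i (jmax i))

Edge : {m n : ℕ} → Instance m n → ℚ → (Fin m → Fin n) → Fin m → Fin m → Set
Edge p T jmax i i' = Legal p T i' (jmax i)

-- A matching in G_{α,γ} saturating Bad(α,γ): an injective map sending each
-- bad machine to a good machine adjacent to it.
BadSaturatingMatching : {m n : ℕ} → Instance m n → Assignment m n →
  ℚ → ℚ → ℚ → (Fin m → Fin n) → Set
BadSaturatingMatching {m} p α T L γ jmax =
  Σ ((i : Fin m) → Bad p α T L γ i → Fin m) λ f →
    (∀ i (b : Bad p α T L γ i) → Good p α L γ (f i b) × Edge p T jmax i (f i b))
    × (∀ i i' (b : Bad p α T L γ i) (b' : Bad p α T L γ i') → f i b ≡ f i' b' → i ≡ i')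

divPos : ℚ → (y : ℚ) → 0ℚ < y → ℚ
divPos x y ypos = _÷_ x y {{pos⇒nonZero y {{positive ypos}}}}

-- Let b be the number of bad machines and g the number of machines that are not good.
-- Every bad machine carries load more than T + L/h and every non-good one more than L/h, so
-- bT + gL/h is less than the total load mL; with L ≤ hT this gives b + g < hm, and hm is at most
-- the number of machines legal for any job.  Hence the maximal job of every bad machine has more
-- than b legal good machines, and matching the bad machines greedily never gets stuck.
module Submission where

open import Defs
open import Level using (Level)
open import Algebra.Bundles using (CommutativeMonoid)
open import Data.Nat as ℕ using (ℕ; NonZero; suc)
import Data.Nat.Properties as ℕ
open import Data.Fin as Fin using (Fin)
open import Data.Integer as ℤ using (+_)
import Data.Integer.Properties as ℤ
open import Data.Integer.Tactic.RingSolver using (solve-∀)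
open import Data.Rational hiding (NonZero)
open import Data.Rational.Properties
open import Data.Rational.Solver using (module +-*-Solver)
import Data.Rational.Unnormalised as ℚᵘ
import Data.Rational.Unnormalised.Properties as ℚᵘ
open import Data.List using (List; []; _∷_; length; map; foldr; filter; allFin)
open import Data.List.Properties using (filter-notAll)
open import Data.List.Membership.Propositional using (_∈_; _∉_; mapWith∈; find)
open import Data.List.Membership.Propositional.Properties using (∈-filter⁺; ∈-filter⁻; ∈-allFin)
open import Data.List.Membership.Setoid.Properties using (length-mapWith∈)
open import Data.List.Relation.Binary.Subset.Propositional using (_⊆_)
open import Data.List.Relation.Unary.All as All using ()
open import Data.List.Relation.Unary.Any as Any using (here; there; any?)
open import Data.List.Relation.Unary.AllPairs using (_∷_)
open import Data.List.Relation.Unary.Unique.Propositional using (Unique)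
open import Data.List.Relation.Unary.Unique.Propositional.Properties using (filter⁺; allFin⁺)
open import Data.Product using (Σ; ∃; _×_; _,_; proj₂)
open import Relation.Binary.Definitions using (DecidableEquality)
open import Relation.Binary.PropositionalEquality using (_≡_; refl; sym; trans; cong; cong₂; subst; setoid; module ≡-Reasoning)
open import Relation.Nullary using (¬_; ¬?; yes; no; contradiction)
open import Relation.Nullary.Decidable using (decidable-stable)
open import Relation.Unary using (Pred; Decidable)
open import Relation.Unary.Properties using (∁?; _∩?_)
open import Algebra.Properties.CommutativeSemigroup
  (CommutativeMonoid.commutativeSemigroup +-0-commutativeMonoid) using (interchange)

private
  variable
    ℓ : Level

module _ {A : Set} (_≟_ : DecidableEquality A) where

  open import Data.List.Membership.DecPropositional _≟_ using (_∈?_)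

  Unique∧⊆⇒length≤ : {xs ys : List A} → Unique xs → xs ⊆ ys → length xs ℕ.≤ length ys
  Unique∧⊆⇒length≤ {[]} _ _ = ℕ.z≤n
  Unique∧⊆⇒length≤ {x ∷ xs} {ys} (x∉xs ∷ !xs) x∷xs⊆ys =
    ℕ.≤-trans (ℕ.s≤s (Unique∧⊆⇒length≤ !xs xs⊆ys-x)) (filter-notAll ≢x? ys x∈ys)
    where
    ≢x? : Decidable (λ y → ¬ y ≡ x)
    ≢x? y = ¬? (y ≟ x)
    xs⊆ys-x : xs ⊆ filter ≢x? ys
    xs⊆ys-x y∈xs = ∈-filter⁺ ≢x? (x∷xs⊆ys (there y∈xs)) λ y≡x → All.lookup x∉xs y∈xs (sym y≡x)
    x∈ys : Any.Any (λ y → ¬ ¬ y ≡ x) ys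
    x∈ys = Any.map (λ x≡y y≢x → y≢x (sym x≡y)) (x∷xs⊆ys (here refl))

  Unique∧longer⇒∃∉ : {xs ys : List A} → Unique xs → length ys ℕ.< length xs → ∃ λ x → x ∈ xs × x ∉ ys
  Unique∧longer⇒∃∉ {xs} {ys} !xs ys<xs with any? (λ x → ¬? (x ∈? ys)) xs
  ... | yes ∃∉ = find ∃∉
  ... | no ∄∉ = contradiction (Unique∧⊆⇒length≤ !xs xs⊆ys) (ℕ.<⇒≱ ys<xs)
    where
    xs⊆ys : xs ⊆ ys
    xs⊆ys {x} x∈xs = decidable-stable (x ∈? ys) λ x∉ys → ∄∉ (Any.map (λ { refl → x∉ys }) x∈xs)

DistinctChoice : {I A : Set} → List I → (I → List A) → Set
DistinctChoice {I} {A} is N =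
  Σ (∀ {i} → i ∈ is → A) λ g →
    (∀ {i} (i∈ : i ∈ is) → g i∈ ∈ N i) ×
    (∀ {i i′} (i∈ : i ∈ is) (i′∈ : i′ ∈ is) → g i∈ ≡ g i′∈ → i ≡ i′)

∈-mapWith∈ : {I A : Set} (is : List I) (g : ∀ {i} → i ∈ is → A) {i : I} (i∈ : i ∈ is) → g i∈ ∈ mapWith∈ is g
∈-mapWith∈ (_ ∷ _) g (here refl) = here refl
∈-mapWith∈ (_ ∷ is) g (there i∈) = there (∈-mapWith∈ is (λ i∈′ → g (there i∈′)) i∈)

-- The easy case of Hall's theorem: when every candidate list is longer than the list of
-- indices, the head index still finds a candidate not taken by the others.
distinctChoice : {I A : Set} → DecidableEquality A → (is : List I) (N : I → List A) →
  (∀ {i} → i ∈ is → Unique (N i)) → (∀ {i} → i ∈ is → length is ℕ.< length (N i)) →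
  DistinctChoice is N
distinctChoice _≟_ [] N _ _ = (λ ()) , (λ ()) , λ ()
distinctChoice {I} {A} _≟_ (i ∷ is) N !N long
  with distinctChoice _≟_ is N (λ i∈ → !N (there i∈)) (λ i∈ → ℕ.<-trans (ℕ.n<1+n _) (long (there i∈)))
... | g , g∈N , g-injective
  with Unique∧longer⇒∃∉ _≟_ {ys = mapWith∈ is g} (!N (here refl))
         (subst (ℕ._< length (N i)) (sym (length-mapWith∈ (setoid I) is)) (ℕ.<-trans (ℕ.n<1+n _) (long (here refl))))
... | a , a∈Ni , a-untaken = g′ , g′∈N , g′-injective
  where
  g′ : ∀ {i′} → i′ ∈ i ∷ is → A
  g′ (here _) = a
  g′ (there i′∈) = g i′∈

  g′∈N : ∀ {i′} (i′∈ : i′ ∈ i ∷ is) → g′ i′∈ ∈ N i′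
  g′∈N (here refl) = a∈Ni
  g′∈N (there i′∈) = g∈N i′∈

  g′-injective : ∀ {i₁ i₂} (i₁∈ : i₁ ∈ i ∷ is) (i₂∈ : i₂ ∈ i ∷ is) → g′ i₁∈ ≡ g′ i₂∈ → i₁ ≡ i₂
  g′-injective (here refl) (here refl) _ = refl
  g′-injective (here _) (there i₂∈) eq = contradiction (subst (_∈ mapWith∈ is g) (sym eq) (∈-mapWith∈ is g i₂∈)) a-untaken
  g′-injective (there i₁∈) (here _) eq = contradiction (subst (_∈ mapWith∈ is g) eq (∈-mapWith∈ is g i₁∈)) a-untaken
  g′-injective (there i₁∈) (there i₂∈) eq = g-injective i₁∈ i₂∈ eq

ι : ℕ → ℚ
ι a = + a / 1

-- Identities for ι are checked on unnormalised rationals, where + a / 1 is literally mkℚᵘ (+ a) 0.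
toℚᵘ-ι : ∀ a → toℚᵘ (ι a) ℚᵘ.≃ ℚᵘ.mkℚᵘ (+ a) 0
toℚᵘ-ι a = toℚᵘ-fromℚᵘ (ℚᵘ.mkℚᵘ (+ a) 0)

ι-+ : ∀ a b → ι (a ℕ.+ b) ≡ ι a + ι b
ι-+ a b = toℚᵘ-injective (begin
  toℚᵘ (ι (a ℕ.+ b))                    ≈⟨ toℚᵘ-ι (a ℕ.+ b) ⟩
  ℚᵘ.mkℚᵘ (+ (a ℕ.+ b)) 0               ≈⟨ ℚᵘ.*≡* (trans (cong (ℤ._* + 1) (ℤ.pos-+ a b)) (distrib (+ a) (+ b))) ⟩
  ℚᵘ.mkℚᵘ (+ a) 0 ℚᵘ.+ ℚᵘ.mkℚᵘ (+ b) 0  ≈⟨ ℚᵘ.+-cong (toℚᵘ-ι a) (toℚᵘ-ι b) ⟨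
  toℚᵘ (ι a) ℚᵘ.+ toℚᵘ (ι b)             ≈⟨ toℚᵘ-homo-+ (ι a) (ι b) ⟨
  toℚᵘ (ι a + ι b)                       ∎)
  where
  open ℚᵘ.≃-Reasoning
  distrib : ∀ x y → (x ℤ.+ y) ℤ.* + 1 ≡ (x ℤ.* + 1 ℤ.+ y ℤ.* + 1) ℤ.* + 1
  distrib = solve-∀

/-*-ι : ∀ a m .{{_ : NonZero m}} → (+ a / m) * ι m ≡ ι a
/-*-ι a (suc k) = toℚᵘ-injective (begin
  toℚᵘ ((+ a / suc k) * ι (suc k))          ≈⟨ toℚᵘ-homo-* (+ a / suc k) (ι (suc k)) ⟩
  toℚᵘ (+ a / suc k) ℚᵘ.* toℚᵘ (ι (suc k))  ≈⟨ ℚᵘ.*-cong (toℚᵘ-fromℚᵘ (ℚᵘ.mkℚᵘ (+ a) k)) (toℚᵘ-ι (suc k)) ⟩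
  ℚᵘ.mkℚᵘ (+ a) k ℚᵘ.* ℚᵘ.mkℚᵘ (+ suc k) 0  ≈⟨ ℚᵘ.*≡* (assoc (+ a) (+ suc k)) ⟩
  ℚᵘ.mkℚᵘ (+ a) 0                            ≈⟨ toℚᵘ-ι a ⟨
  toℚᵘ (ι a)                                 ∎)
  where
  open ℚᵘ.≃-Reasoning
  assoc : ∀ x y → (x ℤ.* y) ℤ.* + 1 ≡ x ℤ.* (y ℤ.* + 1)
  assoc = solve-∀

ι-nonNeg : ∀ a → 0ℚ ≤ ι a
ι-nonNeg a = toℚᵘ-cancel-≤ (ℚᵘ.≤-respʳ-≃ (ℚᵘ.≃-sym (toℚᵘ-ι a))
  (ℚᵘ.*≤* (subst (+ 0 ℤ.≤_) (sym (ℤ.*-identityʳ (+ a))) (ℤ.+≤+ ℕ.z≤n))))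

ι-mono-≤ : ∀ {a b} → a ℕ.≤ b → ι a ≤ ι b
ι-mono-≤ {a} a≤b with ℕ.m≤n⇒∃[o]m+o≡n a≤b
... | o , refl = begin
  ι a          ≡⟨ +-identityʳ (ι a) ⟨
  ι a + 0ℚ     ≤⟨ +-monoʳ-≤ (ι a) (ι-nonNeg o) ⟩
  ι a + ι o    ≡⟨ ι-+ a o ⟨
  ι (a ℕ.+ o)  ∎
  where open ≤-Reasoning

ι-cancel-< : ∀ {a b} → ι a < ι b → a ℕ.< b
ι-cancel-< {a} {b} ιa<ιb with a ℕ.<? b
... | yes a<b = a<b
... | no a≮b = contradiction (<-≤-trans ιa<ιb (ι-mono-≤ (ℕ.≮⇒≥ a≮b))) (<-irrefl refl)

÷≤⇒≤* : ∀ {x y h} (y>0 : 0ℚ < y) → divPos x y y>0 ≤ h → x ≤ h * y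
÷≤⇒≤* {x} {y} {h} y>0 x÷y≤h = begin
  x                   ≡⟨ *-identityʳ x ⟨
  x * 1ℚ              ≡⟨ cong (x *_) (*-inverseˡ y) ⟨
  x * (1/ y * y)      ≡⟨ *-assoc x (1/ y) y ⟨
  divPos x y y>0 * y  ≤⟨ *-monoʳ-≤-nonNeg y x÷y≤h ⟩
  h * y               ∎
  where
  open ≤-Reasoning
  instance
    _ : Positive y
    _ = positive y>0
    _ = pos⇒nonZero y
    _ = pos⇒nonNeg y

module _ {A : Set} where

  ∑ : (A → ℚ) → List A → ℚ
  ∑ f xs = foldr _+_ 0ℚ (map f xs)

  indicator : {P : Pred A ℓ} → Decidable P → ℚ → A → ℚ
  indicator P? c x with P? x
  ... | yes _ = c
  ... | no _ = 0ℚ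

  ∑-nonNeg : ∀ f xs → (∀ x → 0ℚ ≤ f x) → 0ℚ ≤ ∑ f xs
  ∑-nonNeg f [] _ = ≤-refl
  ∑-nonNeg f (x ∷ xs) f≥0 = +-mono-≤ (f≥0 x) (∑-nonNeg f xs f≥0)

  ∑-+ : ∀ f g xs → ∑ (λ x → f x + g x) xs ≡ ∑ f xs + ∑ g xs
  ∑-+ f g [] = refl
  ∑-+ f g (x ∷ xs) = begin
    (f x + g x) + ∑ (λ x → f x + g x) xs  ≡⟨ cong (_+_ (f x + g x)) (∑-+ f g xs) ⟩
    (f x + g x) + (∑ f xs + ∑ g xs)       ≡⟨ interchange (f x) (g x) (∑ f xs) (∑ g xs) ⟩
    (f x + ∑ f xs) + (g x + ∑ g xs)       ∎
    where open ≡-Reasoning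

  ∑-indicator : ∀ {P : Pred A ℓ} (P? : Decidable P) c xs → ∑ (indicator P? c) xs ≡ ι (length (filter P? xs)) * c
  ∑-indicator P? c [] = sym (*-zeroˡ c)
  ∑-indicator P? c (x ∷ xs) with P? x
  ... | no _ = trans (+-identityˡ _) (∑-indicator P? c xs)
  ... | yes _ = begin
    c + ∑ (indicator P? c) xs  ≡⟨ cong (_+_ c) (∑-indicator P? c xs) ⟩
    c + ι k * c                ≡⟨ cong (_+ ι k * c) (*-identityˡ c) ⟨
    1ℚ * c + ι k * c           ≡⟨ *-distribʳ-+ c 1ℚ (ι k) ⟨
    (1ℚ + ι k) * c             ≡⟨ cong (_* c) (ι-+ 1 k) ⟨
    ι (suc k) * c              ∎
    where
    open ≡-Reasoning
    k = length (filter P? xs)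

  ∑-mono-≤ : ∀ {f g} xs → (∀ x → f x ≤ g x) → ∑ f xs ≤ ∑ g xs
  ∑-mono-≤ [] _ = ≤-refl
  ∑-mono-≤ (x ∷ xs) f≤g = +-mono-≤ (f≤g x) (∑-mono-≤ xs f≤g)

  ∑-mono-< : ∀ {f g k} xs → (∀ x → f x ≤ g x) → k ∈ xs → f k < g k → ∑ f xs < ∑ g xs
  ∑-mono-< (x ∷ xs) f≤g (here refl) fk<gk = +-mono-<-≤ fk<gk (∑-mono-≤ xs f≤g)
  ∑-mono-< (x ∷ xs) f≤g (there k∈xs) fk<gk = +-mono-≤-< (f≤g x) (∑-mono-< xs f≤g k∈xs fk<gk)

  length-filter-split : ∀ {P Q : Pred A ℓ} (P? : Decidable P) (Q? : Decidable Q) xs →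
    length (filter P? xs) ℕ.≤ length (filter (Q? ∩? P?) xs) ℕ.+ length (filter (∁? Q?) xs)
  length-filter-split P? Q? [] = ℕ.z≤n
  length-filter-split P? Q? (x ∷ xs) with P? x | Q? x
  ... | yes _ | yes _ = ℕ.s≤s (length-filter-split P? Q? xs)
  ... | yes _ | no _ = ℕ.≤-trans (ℕ.s≤s (length-filter-split P? Q? xs)) (ℕ.≤-reflexive (sym (ℕ.+-suc _ _)))
  ... | no _ | yes _ = length-filter-split P? Q? xs
  ... | no _ | no _ = ℕ.≤-trans (length-filter-split P? Q? xs) (ℕ.+-monoʳ-≤ _ (ℕ.n≤1+n _))

averageLoad≡⇒sumFin-load≡ : ∀ {m n} .{{_ : NonZero m}} (p : Instance m n) α {L} →
  averageLoad p α ≡ L → sumFin (load p α) ≡ L * ι m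
averageLoad≡⇒sumFin-load≡ {m} p α {L} avg = begin
  S                      ≡⟨ *-identityʳ S ⟨
  S * 1ℚ                 ≡⟨ cong (S *_) (/-*-ι 1 m) ⟨
  S * ((+ 1 / m) * ι m)  ≡⟨ *-assoc S (+ 1 / m) (ι m) ⟨
  (S * (+ 1 / m)) * ι m  ≡⟨ cong (_* ι m) avg ⟩
  L * ι m                ∎
  where
  open ≡-Reasoning
  S = sumFin (load p α)

module _ {m n : ℕ} (p : Instance m n) (α : Assignment m n) (T L h : ℚ) (h>0 : 0ℚ < h) where

  private
    γ = inv h h>0
    δ = load p α

  bad? : Decidable (Bad p α T L γ)
  bad? i = T + γ * L <? δ i

  good? : Decidable (Good p α L γ)
  good? i = δ i ≤? γ * L

  legal? : (j : Fin n) → Decidable (λ i → Legal p T i j)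
  legal? j i = p i j ≤? T

  badMachines : List (Fin m)
  badMachines = filter bad? (allFin m)

  #bad #notGood : ℕ
  #bad = length badMachines
  #notGood = length (filter (∁? good?) (allFin m))

  goodLegalMachines : Fin n → List (Fin m)
  goodLegalMachines j = filter (good? ∩? legal? j) (allFin m)

  loadLowerBound : Fin m → ℚ
  loadLowerBound i = indicator bad? T i + indicator (∁? good?) (γ * L) i

  module _ (T≥0 : 0ℚ ≤ T) (δ≥0 : ∀ i → 0ℚ ≤ δ i) where

    bad⇒¬good : ∀ {i} → Bad p α T L γ i → ¬ Good p α L γ i
    bad⇒¬good {i} bad good = <-irrefl refl (begin-strict
      γ * L       ≡⟨ +-identityˡ (γ * L) ⟨
      0ℚ + γ * L  ≤⟨ +-monoˡ-≤ (γ * L) T≥0 ⟩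
      T + γ * L   <⟨ bad ⟩
      δ i         ≤⟨ good ⟩
      γ * L       ∎)
      where open ≤-Reasoning

    loadLowerBound≤load : ∀ i → loadLowerBound i ≤ δ i
    loadLowerBound≤load i with bad? i | good? i
    ... | yes bad | yes good = contradiction good (bad⇒¬good bad)
    ... | yes bad | no _ = <⇒≤ bad
    ... | no _ | yes _ = δ≥0 i
    ... | no _ | no ¬good = subst (_≤ δ i) (sym (+-identityˡ (γ * L))) (<⇒≤ (≰⇒> ¬good))

    loadLowerBound<load : ∀ {i} → Bad p α T L γ i → loadLowerBound i < δ i
    loadLowerBound<load {i} bad with bad? i | good? i
    ... | yes _ | yes good = contradiction good (bad⇒¬good bad)
    ... | yes bad | no _ = bad
    ... | no ¬bad | _ = contradiction bad ¬bad

    counts<sumFin-load : ∀ {k} → Bad p α T L γ k → ι #bad * T + ι #notGood * (γ * L) < sumFin δ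
    counts<sumFin-load {k} bad = begin-strict
      ι #bad * T + ι #notGood * (γ * L)
        ≡⟨ cong₂ _+_ (∑-indicator bad? T (allFin m)) (∑-indicator (∁? good?) (γ * L) (allFin m)) ⟨
      ∑ (indicator bad? T) (allFin m) + ∑ (indicator (∁? good?) (γ * L)) (allFin m)
        ≡⟨ ∑-+ (indicator bad? T) (indicator (∁? good?) (γ * L)) (allFin m) ⟨
      ∑ loadLowerBound (allFin m)
        <⟨ ∑-mono-< (allFin m) loadLowerBound≤load (∈-allFin k) (loadLowerBound<load bad) ⟩
      sumFin δ ∎
      where open ≤-Reasoning

    module _ (L>0 : 0ℚ < L) (L≤hT : L ≤ h * T) (sumFin-δ≡ : sumFin δ ≡ L * ι m) where

      private instance
        _ = positive h>0
        _ = pos⇒nonNeg L {{positive L>0}}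

      counts<hm : ∀ {k} → Bad p α T L γ k → ι (#bad ℕ.+ #notGood) < h * ι m
      counts<hm {k} bad = *-cancelʳ-<-nonNeg L (begin-strict
        ι (#bad ℕ.+ #notGood) * L                      ≡⟨ trans (cong (_* L) (ι-+ #bad #notGood)) (*-distribʳ-+ L (ι #bad) (ι #notGood)) ⟩
        ι #bad * L + ι #notGood * L                    ≤⟨ +-monoˡ-≤ (ι #notGood * L) (*-monoˡ-≤-nonNeg (ι #bad) {{nonNegative (ι-nonNeg #bad)}} L≤hT) ⟩
        ι #bad * (h * T) + ι #notGood * L              ≡⟨ cong (λ z → ι #bad * (h * T) + ι #notGood * z) (trans (cong (_* L) hγ≡1) (*-identityˡ L)) ⟨
        ι #bad * (h * T) + ι #notGood * ((h * γ) * L)  ≡⟨ factor-h (ι #bad) (ι #notGood) h T γ L ⟩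
        h * (ι #bad * T + ι #notGood * (γ * L))        <⟨ *-monoʳ-<-pos h (counts<sumFin-load bad) ⟩
        h * sumFin δ                                   ≡⟨ cong (h *_) sumFin-δ≡ ⟩
        h * (L * ι m)                                  ≡⟨ swap h L (ι m) ⟩
        (h * ι m) * L                                  ∎)
        where
        open ≤-Reasoning
        open +-*-Solver
        hγ≡1 : h * γ ≡ 1ℚ
        hγ≡1 = *-inverseʳ h {{pos⇒nonZero h}}
        factor-h : ∀ a b h T γ L → a * (h * T) + b * ((h * γ) * L) ≡ h * (a * T + b * (γ * L))
        factor-h = solve 6 (λ a b h T γ L → a :* (h :* T) :+ b :* ((h :* γ) :* L) := h :* (a :* T :+ b :* (γ :* L))) refl
        swap : ∀ h L x → h * (L * x) ≡ (h * x) * L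
        swap = solve 3 (λ h L x → h :* (L :* x) := (h :* x) :* L) refl

      #bad<#goodLegal : .{{_ : NonZero m}} → (∀ j → h ≤ (+ legalCount p T j) / m) →
        ∀ {k} j → Bad p α T L γ k → #bad ℕ.< length (goodLegalMachines j)
      #bad<#goodLegal h≤ j bad = ℕ.+-cancelʳ-< #notGood #bad _
        (ℕ.<-≤-trans (ι-cancel-< counts<legalCount) (length-filter-split (legal? j) good? (allFin m)))
        where
        open ≤-Reasoning
        counts<legalCount : ι (#bad ℕ.+ #notGood) < ι (legalCount p T j)
        counts<legalCount = begin-strict
          ι (#bad ℕ.+ #notGood)           <⟨ counts<hm bad ⟩
          h * ι m                         ≤⟨ *-monoʳ-≤-nonNeg (ι m) {{nonNegative (ι-nonNeg m)}} (h≤ j) ⟩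
          (+ legalCount p T j / m) * ι m  ≡⟨ /-*-ι (legalCount p T j) m ⟩
          ι (legalCount p T j)            ∎

  badSaturatingMatching : (jmax : Fin m → Fin n) →
    (∀ {k} j → Bad p α T L γ k → #bad ℕ.< length (goodLegalMachines j)) →
    BadSaturatingMatching p α T L γ jmax
  badSaturatingMatching jmax fewBad
    with distinctChoice Fin._≟_ badMachines (λ k → goodLegalMachines (jmax k))
           (λ {k} _ → filter⁺ (good? ∩? legal? (jmax k)) (allFin⁺ m))
           (λ {k} k∈bad → fewBad (jmax k) (proj₂ (∈-filter⁻ bad? {xs = allFin m} k∈bad)))
  ... | g , g∈goodLegal , g-injective =
    (λ _ bad → g (∈bad bad)) ,
    (λ i bad → proj₂ (∈-filter⁻ (good? ∩? legal? (jmax i)) {xs = allFin m} (g∈goodLegal (∈bad bad)))) ,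
    (λ _ _ bad bad′ → g-injective (∈bad bad) (∈bad bad′))
    where
    ∈bad : ∀ {i} → Bad p α T L γ i → i ∈ badMachines
    ∈bad {i} = ∈-filter⁺ bad? (∈-allFin i)

corollary4 : (m n : ℕ) .{{_ : NonZero m}} (p : Instance m n) →
    (∀ i j → 0ℚ ≤ p i j) →
    (T L : ℚ) (Tpos : 0ℚ < T) → 0ℚ < L → L ≤ T →
    (h : ℚ) → IsFeasibilityFactor p T h → (hpos : 0ℚ < h) → h ≤ 1ℚ →
    divPos L T Tpos ≤ h →
    (α : Assignment m n) →
    MakespanAtMost p α ((+ 2 / 1) * T) →
    averageLoad p α ≡ L →
    (jmax : Fin m → Fin n) → IsMaxJobChoice p α jmax →
    BadSaturatingMatching p α T L (inv h hpos) jmax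
corollary4 m n p p≥0 T L T>0 L>0 _ h (h≤legal , _) h>0 _ L/T≤h α _ avg jmax _ =
  badSaturatingMatching p α T L h h>0 jmax
    (#bad<#goodLegal p α T L h h>0 (<⇒≤ T>0) load≥0 L>0 (÷≤⇒≤* T>0 L/T≤h) (averageLoad≡⇒sumFin-load≡ p α avg) h≤legal)
  where
  load≥0 : ∀ i → 0ℚ ≤ load p α i
  load≥0 i = ∑-nonNeg (p i) (filter (λ j → α j Fin.≟ i) (allFin n)) (p≥0 i)
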